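{- Let $G$ be a nontrivial finite group and $r$ a prime. If $r$ is odd, then $G$ is $r$-rotational if and only if $G$ has a fixed-point-free automorphism $\sigma$ whose order is a power of $r$. If $r=2$, then $G$ is $2$-rotational if and only if $G$ has an automorphism $\sigma$ whose order is a power of $2$ such that both $\sigma$ and $\sigma^2$ are fixed-point-free.
   Context: Let $G^*=G\setminus\{1\}$. A partition of a set is a collection of non-empty pairwise disjoint subsets whose union is the set. For an integer $r\geq2$, $G$ is $r$-rotational if there exist $\sigma\in\mathrm{Aut}(G)$ and a subset $S\subseteq G^*$ with $S^{ -1}=S$ such that $\{S,S^{\sigma},\dots,S^{\sigma^{r-1}}\}$ is a partition of $G^*$ (these $r$ sets being pairwise disjoint and non-empty). An automorphism is fixed-point-free if it fixes no non-identity element of $G$. -}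

module Defs where

open import Data.Nat using (ℕ; zero; suc; _<_; _^_)
open import Data.Fin using (Fin)
open import Data.Bool using (Bool; true)
open import Data.Product using (Σ; ∃; _×_; _,_)
open import Relation.Binary.PropositionalEquality using (_≡_; _≢_)
open import Relation.Nullary using (¬_)
open import Algebra.Core using (Op₁; Op₂)
open import Algebra.Structures using (IsGroup)
open import Function.Definitions using (Bijective)

-- A finite group of order n, realised on the carrier Fin n
-- (every finite group is isomorphic to one of these).
record FinGroup (n : ℕ) : Set where
  field
    _∙_     : Op₂ (Fin n)
    ε       : Fin n
    _⁻¹     : Op₁ (Fin n)
    isGroup : IsGroup _≡_ _∙_ ε _⁻¹

module _ {n : ℕ} (G : FinGroup n) where
  open FinGroup G

  record Aut : Set where
    field
      fun       : Fin n → Fin n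
      hom       : ∀ x y → fun (x ∙ y) ≡ fun x ∙ fun y
      bijective : Bijective _≡_ _≡_ fun

  Subset : Set
  Subset = Fin n → Bool

  _∈_ : Fin n → Subset → Set
  x ∈ S = S x ≡ true

  FixedPointFree : (Fin n → Fin n) → Set
  FixedPointFree f = ∀ x → f x ≡ x → x ≡ ε

  InImage : (Fin n → Fin n) → Subset → Fin n → Set
  InImage f S x = ∃ λ s → s ∈ S × f s ≡ x

_^[_] : {A : Set} → (A → A) → ℕ → A → A
(f ^[ zero ]) x  = x
(f ^[ suc i ]) x = f ((f ^[ i ]) x)

HasOrder : {A : Set} → (A → A) → ℕ → Set
HasOrder f m =
  0 < m × (∀ x → (f ^[ m ]) x ≡ x) ×
  (∀ j → 0 < j → j < m → ¬ (∀ x → (f ^[ j ]) x ≡ x))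

OrderIsPowerOf : {A : Set} → ℕ → (A → A) → Set
OrderIsPowerOf r f = ∃ λ m → ∃ λ k → HasOrder f m × m ≡ r ^ k

module _ {n : ℕ} (G : FinGroup n) where
  open FinGroup G

  -- G is r-rotational: there are σ ∈ Aut(G) and S ⊆ G* with S⁻¹ = S such that
  -- S, S^σ, …, S^(σ^(r-1)) form a partition of G* (pairwise disjoint, non-empty,
  -- union G*).
  Rotational : ℕ → Set
  Rotational r = Σ (Aut G) λ σ → Σ (Subset G) λ S →
    let f = Aut.fun σ in
    (∀ x → _∈_ G x S → x ≢ ε) ×
    (∀ x → _∈_ G x S → _∈_ G (x ⁻¹) S) ×
    (∀ (i : Fin r) → ∃ λ x → InImage G (f ^[ Data.Fin.toℕ i ]) S x) ×
    (∀ (i j : Fin r) → i ≢ j → ∀ x →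
       InImage G (f ^[ Data.Fin.toℕ i ]) S x →
       ¬ InImage G (f ^[ Data.Fin.toℕ j ]) S x) ×
    (∀ x → x ≢ ε → ∃ λ (i : Fin r) → InImage G (f ^[ Data.Fin.toℕ i ]) S x)

module Submission where

-- Say that σ rotates by r if, for z ≠ 1, σ^d z ∈ {z, z⁻¹} forces r ∣ d.  A rotational
-- partition gives this: the index of the layer S^(σ^i) containing x is shifted by d under σ^d
-- and is unchanged under inversion.  Conversely, if σ rotates by r, choose a base point c in
-- every orbit of ⟨σ, x ↦ x⁻¹⟩; an exponent j with σ^j c ∈ {x, x⁻¹} is then well defined mod r,
-- and S = {x ≠ 1 : r ∣ j} yields a rotational partition.
--
-- For prime r write n! = r^a m with r ∤ m: σ^m still rotates by r and has r-power order.  A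
-- rotation by r ≥ 2 is fixed-point-free, and a rotation by 2 has fixed-point-free square,
-- because a fixed-point-free automorphism inverts every element fixed by its square.  Conversely,
-- if σ is fixed-point-free of order r^k, then σ^d z = z forces r ∣ d by Bézout, and σ^d z = z⁻¹
-- gives σ^(2d) z = z, whence r ∣ d for odd r; for r = 2 apply the same argument to σ².

open import Defs
open import Data.Nat
open import Data.Nat.Properties
open import Data.Nat.Divisibility
open import Data.Nat.DivMod
open import Data.Nat.Coprimality using (Coprime; coprime-Bézout; coprime-divisor)
open import Data.Nat.GCD using (module Bézout)
open import Data.Nat.Induction using (<-rec)
open import Data.Nat.Primality
  using (Prime; prime⇒irreducible; prime⇒nonZero; prime⇒nonTrivial; prime[2]; euclidsLemma)
open import Data.Fin as Fin using (Fin; toℕ; fromℕ<)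
import Data.Fin.Properties as Finₚ
open import Data.Bool using (true)
open import Data.Product
open import Data.Sum using (_⊎_; inj₁; inj₂)
open import Function using (_∘_)
open import Function.Bundles using (_⇔_; mk⇔)
open import Function.Definitions using (Injective; StrictlySurjective; Bijective)
import Function.Construct.Composition as Compose
open import Level using (0ℓ)
open import Algebra.Bundles using (Group)
open import Algebra.Structures using (IsGroup)
import Algebra.Properties.Group as GroupProperties
open import Relation.Binary using (tri<; tri≈; tri>)
open import Relation.Binary.PropositionalEquality
open import Relation.Nullary
open import Relation.Nullary.Decidable using (decidable-stable; dec-true; map′; _×-dec_; _⊎-dec_)
open import Relation.Unary using (Pred; Decidable)

-- Iterates

IsPeriod : {A : Set} → (A → A) → ℕ → Set
IsPeriod f k = ∀ x → (f ^[ k ]) x ≡ x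

module _ {A : Set} (f : A → A) where

  ^[]-+ : ∀ m n x → (f ^[ m + n ]) x ≡ (f ^[ m ]) ((f ^[ n ]) x)
  ^[]-+ zero    n x = refl
  ^[]-+ (suc m) n x = cong f (^[]-+ m n x)

  ^[]-* : ∀ m n x → (f ^[ m * n ]) x ≡ ((f ^[ n ]) ^[ m ]) x
  ^[]-* zero    n x = refl
  ^[]-* (suc m) n x = trans (^[]-+ n (m * n) x) (cong (f ^[ n ]) (^[]-* m n x))

^[]-fixed : {A : Set} {f : A → A} {x : A} → f x ≡ x → ∀ k → (f ^[ k ]) x ≡ x
^[]-fixed         fx≡x zero    = refl
^[]-fixed {f = f} fx≡x (suc k) = trans (cong f (^[]-fixed fx≡x k)) fx≡x

module _ {A : Set} {f : A → A} {x : A} where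

  ^[]-fixed-∣ : ∀ {m k} → m ∣ k → (f ^[ m ]) x ≡ x → (f ^[ k ]) x ≡ x
  ^[]-fixed-∣ {m} (divides q refl) fᵐx≡x = trans (^[]-* f q m x) (^[]-fixed fᵐx≡x q)

  ^[]-fixed-1+ : ∀ {u v} → 1 + u ≡ v → (f ^[ u ]) x ≡ x → (f ^[ v ]) x ≡ x → f x ≡ x
  ^[]-fixed-1+ {u} {v} 1+u≡v fᵘx≡x fᵛx≡x = begin
    f x                ≡⟨ cong f fᵘx≡x ⟨
    (f ^[ 1 + u ]) x   ≡⟨ cong (λ k → (f ^[ k ]) x) 1+u≡v ⟩
    (f ^[ v ]) x       ≡⟨ fᵛx≡x ⟩
    x                  ∎
    where open ≡-Reasoning

  ^[]-fixed-coprime : ∀ {m k} → Coprime m k → (f ^[ m ]) x ≡ x → (f ^[ k ]) x ≡ x → f x ≡ x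
  ^[]-fixed-coprime m⊥k fᵐx≡x fᵏx≡x with coprime-Bézout m⊥k
  ... | Bézout.+- a b eq = ^[]-fixed-1+ eq (^[]-fixed-∣ (n∣m*n b) fᵏx≡x) (^[]-fixed-∣ (n∣m*n a) fᵐx≡x)
  ... | Bézout.-+ a b eq = ^[]-fixed-1+ eq (^[]-fixed-∣ (n∣m*n a) fᵐx≡x) (^[]-fixed-∣ (n∣m*n b) fᵏx≡x)

IsPeriod-^[] : ∀ {A : Set} {f : A → A} {k} m → IsPeriod f k → IsPeriod (f ^[ m ]) k
IsPeriod-^[] {f = f} {k} m perᵏ x =
  trans (sym (^[]-* f k m x)) (^[]-fixed-∣ {f = f} {m = k} (m∣m*n m) (perᵏ x))

module _ {A : Set} {f : A → A} {N : ℕ} .⦃ _ : NonZero N ⦄ (perᴺ : IsPeriod f N) where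

  ^[]-% : ∀ j x → (f ^[ j % N ]) x ≡ (f ^[ j ]) x
  ^[]-% j x = begin
    (f ^[ j % N ]) x                        ≡⟨ cong (f ^[ j % N ]) fᵠᴺx≡x ⟨
    (f ^[ j % N ]) ((f ^[ j / N * N ]) x)   ≡⟨ ^[]-+ f (j % N) (j / N * N) x ⟨
    (f ^[ j % N + j / N * N ]) x            ≡⟨ cong (λ k → (f ^[ k ]) x) (m≡m%n+[m/n]*n j N) ⟨
    (f ^[ j ]) x                            ∎
    where
    open ≡-Reasoning
    fᵠᴺx≡x : (f ^[ j / N * N ]) x ≡ x
    fᵠᴺx≡x = ^[]-fixed-∣ {f = f} {m = N} (n∣m*n (j / N)) (perᴺ x)

  ^[]-inverseˡ : ∀ i x → (f ^[ i * N ∸ i ]) ((f ^[ i ]) x) ≡ x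
  ^[]-inverseˡ i x = begin
    (f ^[ i * N ∸ i ]) ((f ^[ i ]) x)   ≡⟨ ^[]-+ f (i * N ∸ i) i x ⟨
    (f ^[ i * N ∸ i + i ]) x            ≡⟨ cong (λ k → (f ^[ k ]) x) (m∸n+n≡m (m≤m*n i N)) ⟩
    (f ^[ i * N ]) x                    ≡⟨ ^[]-fixed-∣ {f = f} {m = N} (n∣m*n i) (perᴺ x) ⟩
    x                                   ∎
    where open ≡-Reasoning

module _ {A : Set} {f : A → A} (f-inj : Injective _≡_ _≡_ f) where

  ^[]-injective : ∀ k → Injective _≡_ _≡_ (f ^[ k ])
  ^[]-injective zero    = λ eq → eq
  ^[]-injective (suc k) = Compose.injective _≡_ _≡_ _≡_ (^[]-injective k) f-inj

  ^[]-cancel : ∀ {i j u v} → i ≤ j → (f ^[ i ]) u ≡ (f ^[ j ]) v → u ≡ (f ^[ j ∸ i ]) v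
  ^[]-cancel {i} {j} {u} {v} i≤j fⁱu≡fʲv = ^[]-injective i (begin
    (f ^[ i ]) u                    ≡⟨ fⁱu≡fʲv ⟩
    (f ^[ j ]) v                    ≡⟨ cong (λ k → (f ^[ k ]) v) (m+[n∸m]≡n i≤j) ⟨
    (f ^[ i + (j ∸ i) ]) v          ≡⟨ ^[]-+ f i (j ∸ i) v ⟩
    (f ^[ i ]) ((f ^[ j ∸ i ]) v)   ∎)
    where open ≡-Reasoning

^[]-bijective : {A : Set} {f : A → A} → Bijective _≡_ _≡_ f → ∀ k → Bijective _≡_ _≡_ (f ^[ k ])
^[]-bijective f-bij zero    = (λ eq → eq) , λ y → y , λ eq → eq
^[]-bijective f-bij (suc k) = Compose.bijective _≡_ _≡_ _≡_ (^[]-bijective f-bij k) f-bij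

-- Arithmetic

prime⇒1<p : ∀ {p} → Prime p → 1 < p
prime⇒1<p {p} p-prime = nonTrivial⇒n>1 p ⦃ prime⇒nonTrivial p-prime ⦄

¬∣⇒coprime-^ : ∀ {p m} → Prime p → ¬ p ∣ m → ∀ k → Coprime m (p ^ k)
¬∣⇒coprime-^ p-prime p∤m zero    (_ , d∣1) = ∣1⇒≡1 d∣1
¬∣⇒coprime-^ {p} p-prime p∤m (suc k) {d} (d∣m , d∣p*pᵏ) =
  ¬∣⇒coprime-^ p-prime p∤m k (d∣m , coprime-divisor d⊥p d∣p*pᵏ)
  where
  d⊥p : Coprime d p
  d⊥p (e∣d , e∣p) with prime⇒irreducible p-prime e∣p
  ... | inj₁ e≡1  = e≡1
  ... | inj₂ refl = contradiction (∣-trans e∣d d∣m) p∤m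

m≤n⇒o^m∣o^n : ∀ o {m n} → m ≤ n → o ^ m ∣ o ^ n
m≤n⇒o^m∣o^n o {m} m≤n with k , refl ← m≤n⇒∃[o]m+o≡n m≤n =
  subst (o ^ m ∣_) (sym (^-distribˡ-+-* o m k)) (m∣m*n (o ^ k))

m≤n⇒m∣n! : ∀ {m n} .⦃ _ : NonZero m ⦄ → m ≤ n → m ∣ n !
m≤n⇒m∣n! {suc m} m≤n = ∣-trans (m∣m*n (m !)) (m≤n⇒m!∣n! m≤n)

[m+n]%o≡n⇒o∣m : ∀ m n o .⦃ _ : NonZero o ⦄ → (m + n) % o ≡ n → o ∣ m
[m+n]%o≡n⇒o∣m m n o eq = divides ((m + n) / o) (+-cancelʳ-≡ n m _ (begin
  m + n                           ≡⟨ m≡m%n+[m/n]*n (m + n) o ⟩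
  (m + n) % o + (m + n) / o * o   ≡⟨ cong (_+ (m + n) / o * o) eq ⟩
  n + (m + n) / o * o             ≡⟨ +-comm n _ ⟩
  (m + n) / o * o + n             ∎))
  where open ≡-Reasoning

factor-out-powers : ∀ {p} → 1 < p → ∀ m .⦃ _ : NonZero m ⦄ → ∃₂ λ a c → m ≡ p ^ a * c × ¬ p ∣ c
factor-out-powers {p} 1<p = <-rec _ split
  where
  split : ∀ m → (∀ {k} → k < m → .⦃ _ : NonZero k ⦄ → ∃₂ λ a c → k ≡ p ^ a * c × ¬ p ∣ c) →
          .⦃ _ : NonZero m ⦄ → ∃₂ λ a c → m ≡ p ^ a * c × ¬ p ∣ c
  split m rec with p ∣? m
  ... | no p∤m = 0 , m , sym (+-identityʳ m) , p∤m
  ... | yes (divides q refl)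
    with a , c , refl , p∤c ← rec (m<m*n q p ⦃ m*n≢0⇒m≢0 q ⦄ 1<p) ⦃ m*n≢0⇒m≢0 q ⦄ =
    suc a , c , trans (*-comm (p ^ a * c) p) (sym (*-assoc p (p ^ a) c)) , p∤c

-- Periods and orders

module _ {A : Set} {f : A → A} {p : ℕ} (p-prime : Prime p) where

  private instance
    p≢0 : NonZero p
    p≢0 = prime⇒nonZero p-prime

  ^[]-fixed-p-part : ∀ {x b c k} → ¬ p ∣ c →
                     (f ^[ p ^ b * c ]) x ≡ x → (f ^[ p ^ k ]) x ≡ x → (f ^[ p ^ b ]) x ≡ x
  ^[]-fixed-p-part {x} {b} {c} {k} p∤c fʲx≡x fᴺx≡x =
    ^[]-fixed-coprime (¬∣⇒coprime-^ p-prime p∤c k) gᶜx≡x gᴺx≡x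
    where
    gᶜx≡x : ((f ^[ p ^ b ]) ^[ c ]) x ≡ x
    gᶜx≡x = trans (sym (^[]-* f c (p ^ b) x))
                  (^[]-fixed-∣ {f = f} {m = p ^ b * c} (∣-reflexive (*-comm (p ^ b) c)) fʲx≡x)
    gᴺx≡x : ((f ^[ p ^ b ]) ^[ p ^ k ]) x ≡ x
    gᴺx≡x = trans (sym (^[]-* f (p ^ k) (p ^ b) x)) (^[]-fixed-∣ {f = f} {m = p ^ k} (m∣m*n (p ^ b)) fᴺx≡x)

  period-below-prime-power : ∀ {a} → IsPeriod f (p ^ suc a) →
                             ∀ j → 0 < j → j < p ^ suc a → IsPeriod f j → IsPeriod f (p ^ a)
  period-below-prime-power {a} perᴺ j 0<j j<pᵃ⁺¹ perʲ
    with b , c , refl , p∤c ← factor-out-powers (prime⇒1<p p-prime) j ⦃ >-nonZero 0<j ⦄ = λ x →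
    ^[]-fixed-∣ {f = f} (m≤n⇒o^m∣o^n p {b} {a} b≤a)
                (^[]-fixed-p-part {b = b} {k = suc a} p∤c (perʲ x) (perᴺ x))
    where
    b≤a : b ≤ a
    b≤a = ≮⇒≥ λ a<b → <⇒≱ j<pᵃ⁺¹
      (≤-trans (^-monoʳ-≤ p a<b) (m≤m*n (p ^ b) c ⦃ m*n≢0⇒n≢0 (p ^ b) ⦃ >-nonZero 0<j ⦄ ⦄))

prime-power-order : ∀ {n p} {f : Fin n → Fin n} → Prime p → ∀ a → IsPeriod f (p ^ a) → OrderIsPowerOf p f
prime-power-order p-prime zero perᴺ = 1 , 0 , (s≤s z≤n , perᴺ , λ j 0<j j<1 _ → <⇒≱ j<1 0<j) , refl
prime-power-order {p = p} {f} p-prime (suc a) perᴺ with Finₚ.all? (λ x → (f ^[ p ^ a ]) x Fin.≟ x)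
... | yes perᵃ = prime-power-order p-prime a perᵃ
... | no ¬perᵃ = p ^ suc a , suc a , (m^n>0 p ⦃ prime⇒nonZero p-prime ⦄ (suc a) , perᴺ , minimal) , refl
  where
  minimal : ∀ j → 0 < j → j < p ^ suc a → ¬ IsPeriod f j
  minimal j 0<j j<pᵃ⁺¹ perʲ = ¬perᵃ (period-below-prime-power p-prime {a = a} perᴺ j 0<j j<pᵃ⁺¹ perʲ)

-- Finite search

dec-true⁻¹ : ∀ {A : Set} (a? : Dec A) → does a? ≡ true → A
dec-true⁻¹ (yes a) _ = a

IsLeast : ∀ {n ℓ} → Pred (Fin n) ℓ → Fin n → Set ℓ
IsLeast P i = P i × (∀ {j} → j Fin.< i → ¬ P j)

least : ∀ {n ℓ} {P : Pred (Fin n) ℓ} → Decidable P → ∃ P → ∃ (IsLeast P)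
least {suc n} P? (i , pᵢ) with P? Fin.zero
... | yes p₀ = Fin.zero , p₀ , λ ()
least {suc n} P? (Fin.zero  , p₀) | no ¬p₀ = contradiction p₀ ¬p₀
least {suc n} P? (Fin.suc i , pᵢ) | no ¬p₀ with k , pₖ , below ← least (P? ∘ Fin.suc) (i , pᵢ) =
  Fin.suc k , pₖ , λ { {Fin.zero} _ → ¬p₀ ; {Fin.suc j} (s<s j<k) → below j<k }

least-unique : ∀ {n ℓ} {P Q : Pred (Fin n) ℓ} → (∀ {i} → P i → Q i) → (∀ {i} → Q i → P i) →
               ∀ {i j} → IsLeast P i → IsLeast Q j → i ≡ j
least-unique P⇒Q Q⇒P {i} {j} (pᵢ , below-i) (qⱼ , below-j) with Finₚ.<-cmp i j
... | tri< i<j _ _ = contradiction (P⇒Q pᵢ) (below-j i<j)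
... | tri≈ _ i≡j _ = i≡j
... | tri> _ _ j<i = contradiction (Q⇒P qⱼ) (below-i j<i)

injective⇒strictlySurjective : ∀ {n} {f : Fin n → Fin n} →
                               Injective _≡_ _≡_ f → StrictlySurjective _≡_ f
injective⇒strictlySurjective {suc m} {f} f-inj y with Finₚ.any? (λ x → f x Fin.≟ y)
... | yes hit = hit
... | no miss
  with i , j , i<j , gᵢ≡gⱼ ← Finₚ.pigeonhole (n<1+n m) (λ x → Fin.punchOut λ y≡fx → miss (x , sym y≡fx)) =
  contradiction (f-inj (Finₚ.punchOut-injective {i = y} _ _ gᵢ≡gⱼ)) (Finₚ.<⇒≢ i<j)

injective⇒period-n! : ∀ {n} {f : Fin n → Fin n} → Injective _≡_ _≡_ f → IsPeriod f (n !)
injective⇒period-n! {n} {f} f-inj x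
  with i , j , i<j , fⁱx≡fʲx ← Finₚ.pigeonhole (n<1+n n) (λ k → (f ^[ toℕ k ]) x) =
  ^[]-fixed-∣ (m≤n⇒m∣n! ⦃ >-nonZero (m<n⇒0<n∸m i<j) ⦄ j∸i≤n)
              (sym (^[]-cancel f-inj (<⇒≤ i<j) fⁱx≡fʲx))
  where
  j∸i≤n : toℕ j ∸ toℕ i ≤ n
  j∸i≤n = ≤-trans (m∸n≤m (toℕ j) (toℕ i)) (s≤s⁻¹ (Finₚ.toℕ<n j))

module _ {n : ℕ} {P : Pred (Fin n) 0ℓ} (P? : Decidable P) {φ : Fin n → Fin n}
         (φ-closed : ∀ {x} → P x → P (φ x))
         (φ-injective : ∀ {x y} → P x → P y → φ x ≡ φ y → x ≡ y) where

  -- φ|P extended by the identity outside P is an injective map of Fin n; its surjectivity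
  -- shows that φ maps P onto P.
  private
    extend : ∀ x → Dec (P x) → Fin n
    extend x (yes _) = φ x
    extend x (no _)  = x

    extend-injective : ∀ {x y} (px? : Dec (P x)) (py? : Dec (P y)) → extend x px? ≡ extend y py? → x ≡ y
    extend-injective (yes px) (yes py) eq   = φ-injective px py eq
    extend-injective (yes px) (no ¬py) refl = contradiction (φ-closed px) ¬py
    extend-injective (no ¬px) (yes py) refl = contradiction (φ-closed py) ¬px
    extend-injective (no _)   (no _)   eq   = eq

    extend-preimage : ∀ {x y} (px? : Dec (P x)) → P y → extend x px? ≡ y → ∃ λ x → P x × φ x ≡ y
    extend-preimage (yes px) _  eq   = _ , px , eq
    extend-preimage (no ¬px) py refl = contradiction py ¬px

  injective-on⇒surjective-on : ∀ {y} → P y → ∃ λ x → P x × φ x ≡ y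
  injective-on⇒surjective-on {y} py
    with x , ψx≡y ← injective⇒strictlySurjective (λ {x} {y} → extend-injective (P? x) (P? y)) y =
    extend-preimage (P? x) py ψx≡y

-- Automorphisms of a finite group

module _ {n : ℕ} (G : FinGroup n) where

  open FinGroup G
  open IsGroup isGroup using (assoc; identityˡ; inverseˡ)

  private
    group : Group 0ℓ 0ℓ
    group = record { isGroup = isGroup }

  open GroupProperties group
    using (identityʳ-unique; inverseˡ-unique; ⁻¹-involutive; ⁻¹-anti-homo-∙;
           \\-leftDividesˡ; //-rightDividesʳ; x∙y⁻¹≈ε⇒x≈y)

  module _ (σ : Aut G) where

    open Aut σ renaming (fun to f)

    Aut-ε : f ε ≡ ε
    Aut-ε = identityʳ-unique (f ε) (f ε) (trans (sym (hom ε ε)) (cong f (identityˡ ε)))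

    Aut-⁻¹ : ∀ x → f (x ⁻¹) ≡ f x ⁻¹
    Aut-⁻¹ x = inverseˡ-unique (f (x ⁻¹)) (f x)
                 (trans (sym (hom (x ⁻¹) x)) (trans (cong f (inverseˡ x)) Aut-ε))

    Aut-≢ε : ∀ {x} → x ≢ ε → f x ≢ ε
    Aut-≢ε x≢ε fx≡ε = x≢ε (proj₁ bijective (trans fx≡ε (sym Aut-ε)))

  iterateAut : Aut G → ℕ → Aut G
  iterateAut σ k = record
    { fun       = f ^[ k ]
    ; hom       = hom-^[] k
    ; bijective = ^[]-bijective (Aut.bijective σ) k
    }
    where
    f : Fin n → Fin n
    f = Aut.fun σ
    hom-^[] : ∀ k x y → (f ^[ k ]) (x ∙ y) ≡ (f ^[ k ]) x ∙ (f ^[ k ]) y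
    hom-^[] zero    x y = refl
    hom-^[] (suc k) x y = trans (cong f (hom-^[] k x y)) (Aut.hom σ _ _)

  infix 4 _≡±_

  _≡±_ : Fin n → Fin n → Set
  x ≡± y = x ≡ y ⊎ x ≡ y ⁻¹

  _≡±?_ : ∀ x y → Dec (x ≡± y)
  x ≡±? y = (x Fin.≟ y) ⊎-dec (x Fin.≟ y ⁻¹)

  ≡±-refl : ∀ {x} → x ≡± x
  ≡±-refl = inj₁ refl

  ≡±-⁻¹ : ∀ {x} → x ⁻¹ ≡± x
  ≡±-⁻¹ = inj₂ refl

  ≡±-sym : ∀ {x y} → x ≡± y → y ≡± x
  ≡±-sym         (inj₁ refl) = inj₁ refl
  ≡±-sym {y = y} (inj₂ refl) = inj₂ (sym (⁻¹-involutive y))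

  ≡±-trans : ∀ {x y z} → x ≡± y → y ≡± z → x ≡± z
  ≡±-trans (inj₁ refl) y≡±z        = y≡±z
  ≡±-trans (inj₂ refl) (inj₁ refl) = inj₂ refl
  ≡±-trans (inj₂ refl) (inj₂ refl) = inj₁ (⁻¹-involutive _)

  ≡±-map : (σ : Aut G) → ∀ {x y} → x ≡± y → Aut.fun σ x ≡± Aut.fun σ y
  ≡±-map σ (inj₁ refl) = inj₁ refl
  ≡±-map σ (inj₂ refl) = inj₂ (Aut-⁻¹ σ _)

  ≡±-≢ε : ∀ {x y} → x ≡± y → y ≢ ε → x ≢ ε
  ≡±-≢ε         (inj₁ refl) y≢ε = y≢ε
  ≡±-≢ε {y = y} (inj₂ refl) y≢ε y⁻¹≡ε = y≢ε (begin
    y          ≡⟨ ⁻¹-involutive y ⟨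
    y ⁻¹ ⁻¹    ≡⟨ cong _⁻¹ y⁻¹≡ε ⟩
    ε ⁻¹       ≡⟨ inverseˡ-unique ε ε (identityˡ ε) ⟨
    ε          ∎)
    where open ≡-Reasoning

  module _ (σ : Aut G) (σ-fpf : FixedPointFree G (Aut.fun σ)) where

    private
      f : Fin n → Fin n
      f = Aut.fun σ

      twisted : Fin n → Fin n
      twisted h = (h ⁻¹) ∙ f h

      twisted-injective : ∀ {h k} → twisted h ≡ twisted k → h ≡ k
      twisted-injective {h} {k} eq = sym (x∙y⁻¹≈ε⇒x≈y k h (σ-fpf _ (sym (begin
        k ∙ (h ⁻¹)                   ≡⟨ cong (k ∙_) (//-rightDividesʳ (f h) (h ⁻¹)) ⟨
        k ∙ (twisted h ∙ (f h ⁻¹))   ≡⟨ cong (λ t → k ∙ (t ∙ (f h ⁻¹))) eq ⟩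
        k ∙ (twisted k ∙ (f h ⁻¹))   ≡⟨ assoc k _ _ ⟨
        (k ∙ twisted k) ∙ (f h ⁻¹)   ≡⟨ cong (_∙ (f h ⁻¹)) (\\-leftDividesˡ k (f k)) ⟩
        f k ∙ (f h ⁻¹)               ≡⟨ cong (f k ∙_) (Aut-⁻¹ σ h) ⟨
        f k ∙ f (h ⁻¹)               ≡⟨ Aut.hom σ k (h ⁻¹) ⟨
        f (k ∙ (h ⁻¹))               ∎))))
        where open ≡-Reasoning

      twisted-closed : ∀ {h} → f (f h) ≡ h → f (f (twisted h)) ≡ twisted h
      twisted-closed {h} f²h≡h = begin
        f (f ((h ⁻¹) ∙ f h))          ≡⟨ cong f (Aut.hom σ _ _) ⟩
        f (f (h ⁻¹) ∙ f (f h))        ≡⟨ Aut.hom σ _ _ ⟩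
        f (f (h ⁻¹)) ∙ f (f (f h))    ≡⟨ cong₂ _∙_ f²h⁻¹≡h⁻¹ (cong f f²h≡h) ⟩
        (h ⁻¹) ∙ f h                  ∎
        where
        open ≡-Reasoning
        f²h⁻¹≡h⁻¹ : f (f (h ⁻¹)) ≡ h ⁻¹
        f²h⁻¹≡h⁻¹ = trans (cong f (Aut-⁻¹ σ h)) (trans (Aut-⁻¹ σ (f h)) (cong _⁻¹ f²h≡h))

    fixedPointFree⇒inverts : ∀ {x} → f (f x) ≡ x → f x ≡ x ⁻¹
    fixedPointFree⇒inverts f²x≡x
      with h , f²h≡h , refl ← injective-on⇒surjective-on (λ g → f (f g) Fin.≟ g) twisted-closed
                                (λ _ _ → twisted-injective) f²x≡x = begin
      f ((h ⁻¹) ∙ f h)           ≡⟨ Aut.hom σ _ _ ⟩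
      f (h ⁻¹) ∙ f (f h)         ≡⟨ cong₂ _∙_ (Aut-⁻¹ σ h) f²h≡h ⟩
      (f h ⁻¹) ∙ h               ≡⟨ cong ((f h ⁻¹) ∙_) (⁻¹-involutive h) ⟨
      (f h ⁻¹) ∙ (h ⁻¹ ⁻¹)       ≡⟨ ⁻¹-anti-homo-∙ (h ⁻¹) (f h) ⟨
      ((h ⁻¹) ∙ f h) ⁻¹          ∎
      where open ≡-Reasoning

  nontrivial-element : 2 ≤ n → ∃ λ x → x ≢ ε
  nontrivial-element 2≤n with fromℕ< {0} (<-trans z<s 2≤n) Fin.≟ ε
  ... | no x₀≢ε  = _ , x₀≢ε
  ... | yes x₀≡ε = fromℕ< 2≤n , λ x₁≡ε →
    contradiction (Finₚ.fromℕ<-injective 0 1 _ _ (trans x₀≡ε (sym x₁≡ε))) λ ()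

  -- Rotations

  Rotates : ℕ → (Fin n → Fin n) → Set
  Rotates r f = ∀ z d → z ≢ ε → (f ^[ d ]) z ≡± z → r ∣ d

  module RotationLayers {r : ℕ} .⦃ _ : NonZero r ⦄ (σ : Aut G) (S : Subset G)
    (S-nontrivial : ∀ x → S x ≡ true → x ≢ ε)
    (S-inverse-closed : ∀ x → S x ≡ true → S (x ⁻¹) ≡ true)
    (disjoint : ∀ (i j : Fin r) → i ≢ j → ∀ x →
                InImage G (Aut.fun σ ^[ toℕ i ]) S x → ¬ InImage G (Aut.fun σ ^[ toℕ j ]) S x)
    (cover : ∀ x → x ≢ ε → ∃ λ (i : Fin r) → InImage G (Aut.fun σ ^[ toℕ i ]) S x) where

    private
      f : Fin n → Fin n
      f = Aut.fun σ

    Layer : ℕ → Fin n → Set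
    Layer i = InImage G (f ^[ i ]) S

    layer-cover : ∀ {x} → x ≢ ε → ∃ λ i → i < r × Layer i x
    layer-cover x≢ε with i , Lᵢx ← cover _ x≢ε = toℕ i , Finₚ.toℕ<n i , Lᵢx

    layer-disjoint : ∀ {i j x} → i < r → j < r → Layer i x → Layer j x → i ≡ j
    layer-disjoint {i} {j} {x} i<r j<r Lᵢx Lⱼx = decidable-stable (i ≟ j) λ i≢j →
      disjoint (fromℕ< i<r) (fromℕ< j<r) (i≢j ∘ Finₚ.fromℕ<-injective i j i<r j<r) x
               (reindex i<r Lᵢx) (reindex j<r Lⱼx)
      where
      reindex : ∀ {k} (k<r : k < r) → Layer k x → Layer (toℕ (fromℕ< k<r)) x
      reindex k<r = subst (λ k → Layer k x) (sym (Finₚ.toℕ-fromℕ< k<r))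

    -- If σ^r s lay in the layer i > 0, then s would lie both in S and in the layer r - i.
    S-closed-^r : ∀ {s} → S s ≡ true → S ((f ^[ r ]) s) ≡ true
    S-closed-^r {s} s∈S with layer-cover (Aut-≢ε (iterateAut σ r) (S-nontrivial s s∈S))
    ... | zero , _ , u , u∈S , u≡fʳs = subst (λ y → S y ≡ true) u≡fʳs u∈S
    ... | suc i , i<r , u , u∈S , fⁱu≡fʳs =
      contradiction (layer-disjoint (∸-monoʳ-< z<s (<⇒≤ i<r)) (>-nonZero⁻¹ r)
                                    (s , s∈S , sym (^[]-cancel (proj₁ (Aut.bijective σ)) (<⇒≤ i<r) fⁱu≡fʳs))
                                    (u , u∈S , refl))
                    (>⇒≢ (m<n⇒0<n∸m i<r))

    S-closed-* : ∀ q {s} → S s ≡ true → S ((f ^[ q * r ]) s) ≡ true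
    S-closed-* zero        s∈S = s∈S
    S-closed-* (suc q) {s} s∈S =
      subst (λ y → S y ≡ true) (sym (^[]-+ f r (q * r) s)) (S-closed-^r (S-closed-* q s∈S))

    layer-% : ∀ {t x} → Layer t x → Layer (t % r) x
    layer-% {t} {x} Lₜx with s , s∈S , e ← subst (λ k → Layer k x) (m≡m%n+[m/n]*n t r) Lₜx =
      (f ^[ t / r * r ]) s , S-closed-* (t / r) s∈S , trans (sym (^[]-+ f (t % r) (t / r * r) s)) e

    layer-unique : ∀ {i j x} → Layer i x → Layer j x → i % r ≡ j % r
    layer-unique {i} {j} Lᵢx Lⱼx = layer-disjoint (m%n<n i r) (m%n<n j r) (layer-% Lᵢx) (layer-% Lⱼx)

    layer-shift : ∀ {i x} d → Layer i x → Layer (d + i) ((f ^[ d ]) x)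
    layer-shift {i} d (s , s∈S , refl) = s , s∈S , ^[]-+ f d i s

    layer-≡± : ∀ {i x y} → y ≡± x → Layer i x → Layer i y
    layer-≡±     (inj₁ refl) Lᵢx = Lᵢx
    layer-≡± {i} (inj₂ refl) (s , s∈S , refl) =
      s ⁻¹ , S-inverse-closed s s∈S , Aut-⁻¹ (iterateAut σ i) s

    rotates : Rotates r f
    rotates z d z≢ε fᵈz≡±z with i , i<r , Lᵢz ← layer-cover z≢ε =
      [m+n]%o≡n⇒o∣m d i r
        (trans (layer-unique (layer-shift d Lᵢz) (layer-≡± {i} fᵈz≡±z Lᵢz)) (m<n⇒m%n≡m i<r))

  rotational⇒rotates : ∀ {r} .⦃ _ : NonZero r ⦄ → Rotational G r →
                       Σ (Aut G) λ σ → Rotates r (Aut.fun σ)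
  rotational⇒rotates (σ , S , S-nontrivial , S-inverse-closed , _ , disjoint , cover) =
    σ , RotationLayers.rotates σ S S-nontrivial S-inverse-closed disjoint cover

  module PhaseLayers {r : ℕ} .⦃ _ : NonZero r ⦄ (σ : Aut G) (σ-rot : Rotates r (Aut.fun σ)) where

    private
      f : Fin n → Fin n
      f = Aut.fun σ

      instance
        n!≢0 : NonZero (n !)
        n!≢0 = n !≢0

      period : IsPeriod f (n !)
      period = injective⇒period-n! (proj₁ (Aut.bijective σ))

    Orbit : Fin n → Fin n → Set
    Orbit x y = ∃ λ j → (f ^[ j ]) y ≡± x

    orbit? : ∀ x y → Dec (Orbit x y)
    orbit? x y = map′ (λ (j , e) → toℕ j , e) bounded (Finₚ.any? λ j → (f ^[ toℕ j ]) y ≡±? x)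
      where
      bounded : Orbit x y → ∃ λ (j : Fin (n !)) → (f ^[ toℕ j ]) y ≡± x
      bounded (j , e) = fromℕ< (m%n<n j (n !)) , subst (_≡± x) fʲy≡ e
        where
        fʲy≡ : (f ^[ j ]) y ≡ (f ^[ toℕ (fromℕ< (m%n<n j (n !))) ]) y
        fʲy≡ = trans (sym (^[]-% {N = n !} period j y))
                     (cong (λ k → (f ^[ k ]) y) (sym (Finₚ.toℕ-fromℕ< (m%n<n j (n !)))))

    orbit-refl : ∀ {x} → Orbit x x
    orbit-refl = 0 , ≡±-refl

    orbit-trans : ∀ {x y z} → Orbit x y → Orbit y z → Orbit x z
    orbit-trans {z = z} (i , fⁱy≡±x) (j , fʲz≡±y) =
      i + j , ≡±-trans (subst (_≡± _) (sym (^[]-+ f i j z)) (≡±-map (iterateAut σ i) fʲz≡±y)) fⁱy≡±x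

    orbit-sym : ∀ {x y} → Orbit x y → Orbit y x
    orbit-sym {x} {y} (i , fⁱy≡±x) =
      i * n ! ∸ i ,
      subst (_ ≡±_) (^[]-inverseˡ {N = n !} period i y)
                    (≡±-map (iterateAut σ (i * n ! ∸ i)) (≡±-sym fⁱy≡±x))

    private
      leastInOrbit : ∀ x → ∃ (IsLeast (Orbit x))
      leastInOrbit x = least (orbit? x) (x , orbit-refl)

    base : Fin n → Fin n
    base x = proj₁ (leastInOrbit x)

    base-orbit : ∀ x → Orbit x (base x)
    base-orbit x = proj₁ (proj₂ (leastInOrbit x))

    base-cong : ∀ {x y} → Orbit x y → base x ≡ base y
    base-cong {x} {y} x~y = least-unique (orbit-trans (orbit-sym x~y)) (orbit-trans x~y)
                                         (proj₂ (leastInOrbit x)) (proj₂ (leastInOrbit y))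

    -- Any exponent would do: only its residue mod r is used, and that is determined by x.
    phase : Fin n → ℕ
    phase x = proj₁ (base-orbit x)

    phase-spec : ∀ {x y} → Orbit y x → (f ^[ phase y ]) (base x) ≡± y
    phase-spec {x} {y} y~x = subst (λ g → (f ^[ phase y ]) g ≡± y) (base-cong y~x) (proj₂ (base-orbit y))

    exponent-%-unique-≤ : ∀ {x y i j} → x ≢ ε → i ≤ j →
                          (f ^[ i ]) y ≡± x → (f ^[ j ]) y ≡± x → i % r ≡ j % r
    exponent-%-unique-≤ {x} {y} {i} {j} x≢ε i≤j fⁱy≡±x fʲy≡±x = begin
      i % r             ≡⟨ %-remove-+ˡ i r∣j∸i ⟨
      (j ∸ i + i) % r   ≡⟨ cong (_% r) (m∸n+n≡m i≤j) ⟩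
      j % r             ∎
      where
      open ≡-Reasoning
      fʲ⁻ⁱz≡fʲy : (f ^[ j ∸ i ]) ((f ^[ i ]) y) ≡± (f ^[ j ]) y
      fʲ⁻ⁱz≡fʲy = inj₁ (trans (sym (^[]-+ f (j ∸ i) i y)) (cong (λ k → (f ^[ k ]) y) (m∸n+n≡m i≤j)))
      r∣j∸i : r ∣ j ∸ i
      r∣j∸i = σ-rot _ (j ∸ i) (≡±-≢ε fⁱy≡±x x≢ε)
                    (≡±-trans fʲ⁻ⁱz≡fʲy (≡±-trans fʲy≡±x (≡±-sym fⁱy≡±x)))

    exponent-%-unique : ∀ {x y i j} → x ≢ ε → (f ^[ i ]) y ≡± x → (f ^[ j ]) y ≡± x → i % r ≡ j % r
    exponent-%-unique {i = i} {j} x≢ε fⁱy≡±x fʲy≡±x with ≤-total i j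
    ... | inj₁ i≤j = exponent-%-unique-≤ x≢ε i≤j fⁱy≡±x fʲy≡±x
    ... | inj₂ j≤i = sym (exponent-%-unique-≤ x≢ε j≤i fʲy≡±x fⁱy≡±x)

    phase-^[] : ∀ {x} t → x ≢ ε → phase ((f ^[ t ]) x) % r ≡ (t + phase x) % r
    phase-^[] {x} t x≢ε = exponent-%-unique (Aut-≢ε (iterateAut σ t) x≢ε) (phase-spec (t , ≡±-refl))
      (subst (_≡± _) (sym (^[]-+ f t (phase x) (base x))) (≡±-map (iterateAut σ t) (proj₂ (base-orbit x))))

    phase-⁻¹ : ∀ {x} → x ≢ ε → phase (x ⁻¹) % r ≡ phase x % r
    phase-⁻¹ {x} x≢ε = exponent-%-unique (≡±-≢ε ≡±-⁻¹ x≢ε) (phase-spec (0 , ≡±-sym ≡±-⁻¹))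
      (≡±-trans (proj₂ (base-orbit x)) (≡±-sym ≡±-⁻¹))

    S : Subset G
    S x = does (¬? (x Fin.≟ ε) ×-dec r ∣? phase x)

    S-spec : ∀ {x} → S x ≡ true → x ≢ ε × r ∣ phase x
    S-spec {x} = dec-true⁻¹ (¬? (x Fin.≟ ε) ×-dec r ∣? phase x)

    S-intro : ∀ {x} → x ≢ ε → r ∣ phase x → S x ≡ true
    S-intro {x} x≢ε r∣phase = dec-true (¬? (x Fin.≟ ε) ×-dec r ∣? phase x) (x≢ε , r∣phase)

    S-inverse-closed : ∀ x → S x ≡ true → S (x ⁻¹) ≡ true
    S-inverse-closed x x∈S with x≢ε , r∣phase ← S-spec x∈S =
      S-intro (≡±-≢ε ≡±-⁻¹ x≢ε) (m%n≡0⇒n∣m _ r (trans (phase-⁻¹ x≢ε) (n∣m⇒m%n≡0 _ r r∣phase)))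

    layer-index : ∀ {s i x} → S s ≡ true → (f ^[ i ]) s ≡ x → i % r ≡ phase x % r
    layer-index {s} {i} s∈S refl with s≢ε , r∣phase ← S-spec s∈S = begin
      i % r                      ≡⟨ %-remove-+ʳ i r∣phase ⟨
      (i + phase s) % r          ≡⟨ phase-^[] i s≢ε ⟨
      phase ((f ^[ i ]) s) % r   ∎
      where open ≡-Reasoning

    disjoint : ∀ (i j : Fin r) → i ≢ j → ∀ x →
               InImage G (f ^[ toℕ i ]) S x → ¬ InImage G (f ^[ toℕ j ]) S x
    disjoint i j i≢j x (s , s∈S , fⁱs≡x) (t , t∈S , fʲt≡x) = i≢j (Finₚ.toℕ-injective (begin
      toℕ i         ≡⟨ m<n⇒m%n≡m (Finₚ.toℕ<n i) ⟨
      toℕ i % r     ≡⟨ layer-index s∈S fⁱs≡x ⟩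
      phase x % r   ≡⟨ layer-index t∈S fʲt≡x ⟨
      toℕ j % r     ≡⟨ m<n⇒m%n≡m (Finₚ.toℕ<n j) ⟩
      toℕ j         ∎))
      where open ≡-Reasoning

    preimage : ∀ i x → ∃ λ s → (f ^[ i ]) s ≡ x
    preimage i x = map₂ (λ fⁱ≡ → fⁱ≡ refl) (proj₂ (^[]-bijective (Aut.bijective σ) i) x)

    cover : ∀ x → x ≢ ε → ∃ λ (i : Fin r) → InImage G (f ^[ toℕ i ]) S x
    cover x x≢ε with s , fⁱs≡x ← preimage (phase x % r) x =
      fromℕ< i<r , subst (λ k → InImage G (f ^[ k ]) S x) (sym (Finₚ.toℕ-fromℕ< i<r))
                         (s , S-intro s≢ε r∣phase , fⁱs≡x)
      where
      open ≡-Reasoning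
      i : ℕ
      i = phase x % r
      i<r : i < r
      i<r = m%n<n (phase x) r
      s≢ε : s ≢ ε
      s≢ε s≡ε = x≢ε (trans (sym fⁱs≡x) (trans (cong (f ^[ i ]) s≡ε) (Aut-ε (iterateAut σ i))))
      r∣phase : r ∣ phase s
      r∣phase = [m+n]%o≡n⇒o∣m (phase s) i r (begin
        (phase s + i) % r          ≡⟨ cong (_% r) (+-comm (phase s) i) ⟩
        (i + phase s) % r          ≡⟨ phase-^[] i s≢ε ⟨
        phase ((f ^[ i ]) s) % r   ≡⟨ cong (λ y → phase y % r) fⁱs≡x ⟩
        i                          ∎)

    nonempty : ∀ {x₀} → x₀ ≢ ε → ∀ (i : Fin r) → ∃ λ x → InImage G (f ^[ toℕ i ]) S x
    nonempty x₀≢ε with _ , s , s∈S , _ ← cover _ x₀≢ε = λ i → (f ^[ toℕ i ]) s , s , s∈S , refl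

    rotational : 2 ≤ n → Rotational G r
    rotational 2≤n =
      σ , S , (λ _ → proj₁ ∘ S-spec) , S-inverse-closed ,
      nonempty (proj₂ (nontrivial-element 2≤n)) , disjoint , cover

  rotates⇒rotational : ∀ {r} .⦃ _ : NonZero r ⦄ → 2 ≤ n →
                       (σ : Aut G) → Rotates r (Aut.fun σ) → Rotational G r
  rotates⇒rotational 2≤n σ σ-rot = PhaseLayers.rotational σ σ-rot 2≤n

  rotates-^[] : ∀ {r m} {f : Fin n → Fin n} → Prime r → Rotates r f → ¬ r ∣ m → Rotates r (f ^[ m ])
  rotates-^[] {r} {m} {f} r-prime f-rot r∤m z d z≢ε e
    with euclidsLemma d m r-prime (f-rot z (d * m) z≢ε (subst (_≡± z) (sym (^[]-* f d m z)) e))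
  ... | inj₁ r∣d = r∣d
  ... | inj₂ r∣m = contradiction r∣m r∤m

  rotates⇒rotates-of-prime-power-order : ∀ {r} → Prime r → (σ : Aut G) → Rotates r (Aut.fun σ) →
    Σ (Aut G) λ ρ → Rotates r (Aut.fun ρ) × OrderIsPowerOf r (Aut.fun ρ)
  rotates⇒rotates-of-prime-power-order {r} r-prime σ σ-rot
    with a , m , n!≡rᵃm , r∤m ← factor-out-powers (prime⇒1<p r-prime) (n !) ⦃ n !≢0 ⦄ =
    iterateAut σ m , rotates-^[] r-prime σ-rot r∤m , prime-power-order r-prime a period
    where
    f : Fin n → Fin n
    f = Aut.fun σ
    period : IsPeriod (f ^[ m ]) (r ^ a)
    period x = begin
      ((f ^[ m ]) ^[ r ^ a ]) x   ≡⟨ ^[]-* f (r ^ a) m x ⟨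
      (f ^[ r ^ a * m ]) x        ≡⟨ cong (λ k → (f ^[ k ]) x) n!≡rᵃm ⟨
      (f ^[ n ! ]) x              ≡⟨ injective⇒period-n! (proj₁ (Aut.bijective σ)) x ⟩
      x                           ∎
      where open ≡-Reasoning

  rotates⇒fixedPointFree : ∀ {r f} .⦃ _ : NonTrivial r ⦄ → Rotates r f → FixedPointFree G f
  rotates⇒fixedPointFree f-rot x fx≡x = decidable-stable (x Fin.≟ ε) λ x≢ε →
    nonTrivial⇒≢1 (∣1⇒≡1 (f-rot x 1 x≢ε (inj₁ fx≡x)))

  rotates⇒fixedPointFree-^2 : (σ : Aut G) → Rotates 2 (Aut.fun σ) → FixedPointFree G (Aut.fun σ ^[ 2 ])
  rotates⇒fixedPointFree-^2 σ σ-rot x f²x≡x = decidable-stable (x Fin.≟ ε) λ x≢ε →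
    contradiction (∣1⇒≡1 (σ-rot x 1 x≢ε (inj₂ σx≡x⁻¹))) λ ()
    where
    σx≡x⁻¹ : Aut.fun σ x ≡ x ⁻¹
    σx≡x⁻¹ = fixedPointFree⇒inverts σ (rotates⇒fixedPointFree σ-rot) f²x≡x

  fixedPointFree⇒∣ : ∀ {r k g} → Prime r → FixedPointFree G g → IsPeriod g (r ^ k) →
                     ∀ {z d} → z ≢ ε → (g ^[ d ]) z ≡ z → r ∣ d
  fixedPointFree⇒∣ {r} {k} r-prime g-fpf perᴺ {z} {d} z≢ε gᵈz≡z = decidable-stable (r ∣? d) λ r∤d →
    z≢ε (g-fpf z (^[]-fixed-coprime (¬∣⇒coprime-^ r-prime r∤d k) gᵈz≡z (perᴺ z)))

  inverted⇒fixed-^[2*] : (σ : Aut G) → ∀ {z d} →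
                         (Aut.fun σ ^[ d ]) z ≡ z ⁻¹ → (Aut.fun σ ^[ 2 * d ]) z ≡ z
  inverted⇒fixed-^[2*] σ {z} {d} fᵈz≡z⁻¹ = begin
    (f ^[ 2 * d ]) z            ≡⟨ ^[]-* f 2 d z ⟩
    (f ^[ d ]) ((f ^[ d ]) z)   ≡⟨ cong (f ^[ d ]) fᵈz≡z⁻¹ ⟩
    (f ^[ d ]) (z ⁻¹)           ≡⟨ Aut-⁻¹ (iterateAut σ d) z ⟩
    (f ^[ d ]) z ⁻¹             ≡⟨ cong _⁻¹ fᵈz≡z⁻¹ ⟩
    z ⁻¹ ⁻¹                     ≡⟨ ⁻¹-involutive z ⟩
    z                           ∎
    where
    open ≡-Reasoning
    f : Fin n → Fin n
    f = Aut.fun σ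

  fixedPointFree⇒rotates : ∀ {r k} → Prime r → ¬ 2 ∣ r → (σ : Aut G) → FixedPointFree G (Aut.fun σ) →
                           IsPeriod (Aut.fun σ) (r ^ k) → Rotates r (Aut.fun σ)
  fixedPointFree⇒rotates {k = k} r-prime r-odd σ σ-fpf perᴺ z d z≢ε (inj₁ fᵈz≡z) =
    fixedPointFree⇒∣ {k = k} r-prime σ-fpf perᴺ z≢ε fᵈz≡z
  fixedPointFree⇒rotates {k = k} r-prime r-odd σ σ-fpf perᴺ z d z≢ε (inj₂ fᵈz≡z⁻¹)
    with euclidsLemma 2 d r-prime
           (fixedPointFree⇒∣ {k = k} r-prime σ-fpf perᴺ z≢ε (inverted⇒fixed-^[2*] σ {d = d} fᵈz≡z⁻¹))
  ... | inj₁ r∣2 = contradiction (∣-reflexive (≤-antisym (prime⇒1<p r-prime) (∣⇒≤ r∣2))) r-odd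
  ... | inj₂ r∣d = r∣d

  fixedPointFree-^2⇒rotates : ∀ {k} (σ : Aut G) →
                              FixedPointFree G (Aut.fun σ) → FixedPointFree G (Aut.fun σ ^[ 2 ]) →
                              IsPeriod (Aut.fun σ) (2 ^ k) → Rotates 2 (Aut.fun σ)
  fixedPointFree-^2⇒rotates {k} σ σ-fpf σ²-fpf perᴺ z d z≢ε (inj₁ fᵈz≡z) =
    fixedPointFree⇒∣ {k = k} prime[2] σ-fpf perᴺ z≢ε fᵈz≡z
  fixedPointFree-^2⇒rotates {k} σ σ-fpf σ²-fpf perᴺ z d z≢ε (inj₂ fᵈz≡z⁻¹) =
    fixedPointFree⇒∣ {k = k} prime[2] σ²-fpf (IsPeriod-^[] {k = 2 ^ k} 2 perᴺ) z≢ε (begin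
      ((f ^[ 2 ]) ^[ d ]) z   ≡⟨ ^[]-* f d 2 z ⟨
      (f ^[ d * 2 ]) z        ≡⟨ cong (λ k → (f ^[ k ]) z) (*-comm d 2) ⟩
      (f ^[ 2 * d ]) z        ≡⟨ inverted⇒fixed-^[2*] σ {d = d} fᵈz≡z⁻¹ ⟩
      z                       ∎)
    where
    open ≡-Reasoning
    f : Fin n → Fin n
    f = Aut.fun σ

lemma3p2 : (n : ℕ) (G : FinGroup n) → 2 ≤ n →
    ((r : ℕ) → Prime r → ¬ (2 ∣ r) →
      (Rotational G r ⇔
        Σ (Aut G) λ σ → FixedPointFree G (Aut.fun σ) × OrderIsPowerOf r (Aut.fun σ)))
    ×
    (Rotational G 2 ⇔
      Σ (Aut G) λ σ → OrderIsPowerOf 2 (Aut.fun σ) ×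
        FixedPointFree G (Aut.fun σ) × FixedPointFree G (Aut.fun σ ^[ 2 ]))
lemma3p2 n G 2≤n = odd-case , two-case
  where
  odd-case : (r : ℕ) → Prime r → ¬ (2 ∣ r) →
    Rotational G r ⇔ Σ (Aut G) λ σ → FixedPointFree G (Aut.fun σ) × OrderIsPowerOf r (Aut.fun σ)
  odd-case r r-prime r-odd = mk⇔
    (λ rot → let σ , σ-rot = rotational⇒rotates G rot
                 ρ , ρ-rot , ρ-order = rotates⇒rotates-of-prime-power-order G r-prime σ σ-rot
             in ρ , rotates⇒fixedPointFree G ρ-rot , ρ-order)
    (λ { (σ , σ-fpf , _ , k , (_ , perᴺ , _) , refl) →
         rotates⇒rotational G 2≤n σ (fixedPointFree⇒rotates G {k = k} r-prime r-odd σ σ-fpf perᴺ) })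
    where instance
    r≢0 : NonZero r
    r≢0 = prime⇒nonZero r-prime
    r≢0,1 : NonTrivial r
    r≢0,1 = prime⇒nonTrivial r-prime

  two-case : Rotational G 2 ⇔ Σ (Aut G) λ σ → OrderIsPowerOf 2 (Aut.fun σ) ×
               FixedPointFree G (Aut.fun σ) × FixedPointFree G (Aut.fun σ ^[ 2 ])
  two-case = mk⇔
    (λ rot → let σ , σ-rot = rotational⇒rotates G rot
                 ρ , ρ-rot , ρ-order = rotates⇒rotates-of-prime-power-order G prime[2] σ σ-rot
             in ρ , ρ-order , rotates⇒fixedPointFree G ρ-rot , rotates⇒fixedPointFree-^2 G ρ ρ-rot)
    (λ { (σ , (_ , k , (_ , perᴺ , _) , refl) , σ-fpf , σ²-fpf) →
         rotates⇒rotational G 2≤n σ (fixedPointFree-^2⇒rotates G {k} σ σ-fpf σ²-fpf perᴺ) })
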